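{- Let $\Phi$ be a finite crystallographic root system and let $X\subseteq\Phi$ be a summable set with no vanishing subsum. Then for every integer $1\le p\le |X|$, $X$ has at least $p$ distinct summable subsets of size $|X|-p+1$.
   Context: Let $V$ be a real Euclidean space with scalar product $\langle\cdot,\cdot\rangle$. For $\alpha\neq0$ let $\alpha^\vee=2\alpha/\langle\alpha,\alpha\rangle$ and $s_\alpha(v)=v-\langle\alpha^\vee,v\rangle\alpha$. A finite root system is a finite set $\Phi\subset V\setminus\{0\}$ with $\Phi\cap\mathbb{R}\alpha=\{\alpha,-\alpha\}$ and $s_\alpha\Phi=\Phi$ for all $\alpha\in\Phi$; it is crystallographic if $\langle\alpha^\vee,\beta\rangle\in\mathbb{Z}$ for all $\alpha,\beta\in\Phi$. A set $X\subseteq\Phi$ is summable if the sum of its elements is a root of $\Phi$, and has no vanishing subsum if the sum of every nonempty subset of $X$ is nonzero.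
   Formalization: The ambient space V is taken as ℚ^n with the standard scalar product rather than an arbitrary real Euclidean space. -}

module Defs where

open import Data.Nat as ℕ using (ℕ; _≤_; _∸_)
open import Data.Integer as ℤ using (ℤ)
open import Data.Rational as ℚ using (ℚ; 0ℚ; 1ℚ; _≟_; _÷_; ≢-nonZero)
open import Data.Fin using (Fin)
open import Data.Fin.Subset using (Subset; outside; inside; Nonempty; ∣_∣)
open import Data.Vec as Vec using (Vec; []; _∷_; lookup)
open import Data.List using (List)
open import Data.List.Membership.Propositional using (_∈_)
open import Data.Product using (∃; _×_)
open import Data.Sum using (_⊎_)
open import Relation.Binary.PropositionalEquality using (_≡_; _≢_)
open import Relation.Nullary using (yes; no)

Vector : ℕ → Set
Vector n = Vec ℚ n

0v : ∀ {n} → Vector n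
0v = Vec.replicate _ 0ℚ

_+v_ : ∀ {n} → Vector n → Vector n → Vector n
_+v_ = Vec.zipWith ℚ._+_

-v_ : ∀ {n} → Vector n → Vector n
-v_ = Vec.map (λ x → ℚ.- x)

_-v_ : ∀ {n} → Vector n → Vector n → Vector n
u -v v = u +v (-v v)

_·v_ : ∀ {n} → ℚ → Vector n → Vector n
c ·v v = Vec.map (c ℚ.*_) v

⟨_,_⟩ : ∀ {n} → Vector n → Vector n → ℚ
⟨ u , v ⟩ = Vec.foldr _ ℚ._+_ 0ℚ (Vec.zipWith ℚ._*_ u v)

-- ⟨α^∨, v⟩ = 2⟨α,v⟩/⟨α,α⟩  (set to 0 for α with ⟨α,α⟩ = 0, i.e. α = 0; never used there)
coPair : ∀ {n} → Vector n → Vector n → ℚ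
coPair α v with ⟨ α , α ⟩ ≟ 0ℚ
... | yes _ = 0ℚ
... | no ne = ((ℤ.+ 2 ℚ./ 1) ℚ.* ⟨ α , v ⟩) ÷ ⟨ α , α ⟩
  where instance _ = ≢-nonZero ne

refl-s : ∀ {n} → Vector n → Vector n → Vector n
refl-s α v = v -v (coPair α v ·v α)

record IsRootSystem {n : ℕ} (Φ : List (Vector n)) : Set where
  field
    nonzero   : ∀ {α} → α ∈ Φ → α ≢ 0v
    neg-mem   : ∀ {α} → α ∈ Φ → (-v α) ∈ Φ
    line      : ∀ {α} (c : ℚ) → α ∈ Φ → (c ·v α) ∈ Φ → c ≡ 1ℚ ⊎ c ≡ ℚ.- 1ℚ
    reflClosed : ∀ {α β} → α ∈ Φ → β ∈ Φ → refl-s α β ∈ Φ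

Crystallographic : ∀ {n} → List (Vector n) → Set
Crystallographic Φ = ∀ {α β} → α ∈ Φ → β ∈ Φ → ∃ λ (z : ℤ) → coPair α β ≡ z ℚ./ 1

subsetSum : ∀ {n k} → Vec (Vector n) k → Subset k → Vector n
subsetSum []      []           = 0v
subsetSum (x ∷ X) (outside ∷ S) = subsetSum X S
subsetSum (x ∷ X) (inside ∷ S)  = x +v subsetSum X S

vecSum : ∀ {n k} → Vec (Vector n) k → Vector n
vecSum = Vec.foldr _ _+v_ 0v

-- X (a set of distinct roots, listed as a vector) is summable
Summable : ∀ {n k} → List (Vector n) → Vec (Vector n) k → Set
Summable Φ X = vecSum X ∈ Φ

NoVanishingSubsum : ∀ {n k} → Vec (Vector n) k → Set
NoVanishingSubsum X = ∀ S → Nonempty S → subsetSum X S ≢ 0v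

-- Two roots α, β with ⟨α,β⟩ < 0 sum to a root or to zero: if ⟨α^∨,β⟩ = -1 then α + β = s_α β, and
-- if neither ⟨α^∨,β⟩ nor ⟨β^∨,α⟩ is -1, both are ≤ -2, so 2⟨α,β⟩ ≤ -|α|² - |β|² and |α + β|² ≤ 0.
--
-- Let X = x ∷ ys be summable with no vanishing subsum, |X| ≥ 2, σ = ΣX. Some y in ys has X ∖ {y}
-- summable: if ⟨σ,y⟩ > 0 then σ - y is a root; if ⟨y,x⟩ < 0, replace x and y by the root
-- y + x and recurse on the shorter vector with the same sum; if neither happens for any y, then
-- ⟨Σys,y⟩ = ⟨σ,y⟩ - ⟨x,y⟩ ≤ 0 for all y in ys, so Σys = 0, a vanishing subsum.
-- Iterating, the head x lies in summable subsets of X of every size. For the theorem, remove such a y,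
-- lift the p - 1 subsets given by induction for X ∖ {y}, and add one of the same size containing y.
module Submission where

open import Defs
open import Data.Nat as ℕ using (ℕ; zero; suc; _≤_; _∸_; _+_; s≤s)
import Data.Nat.Properties as ℕP
import Data.Nat.Coprimality as Coprime
import Data.Integer as ℤ
open import Data.Rational as ℚ using (ℚ; 0ℚ; 1ℚ)
import Data.Rational.Properties as ℚP
open import Data.Rational.Solver using (module +-*-Solver)
open import Data.Fin using (Fin; zero; suc; punchIn)
import Data.Fin.Properties as FinP
open import Data.Fin.Subset using (Subset; outside; inside; Nonempty; ∣_∣; ⊤; ⊥)
open import Data.Fin.Subset.Properties using (∣⊤∣≡n)
open import Data.Vec as Vec using (Vec; []; _∷_; lookup; insertAt; removeAt; here; there)
import Data.Vec.Properties as VecP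
open import Data.Vec.Relation.Unary.All as All using (All; []; _∷_)
open import Data.Vec.Relation.Unary.All.Properties using (lookup⁺; lookup⁻)
open import Data.List using (List)
open import Data.List.Membership.Propositional using (_∈_)
open import Data.Product using (∃; _×_; _,_; proj₁; proj₂)
open import Data.Bool using (Bool)
open import Data.Sum using (_⊎_; inj₁; inj₂)
open import Function using (_∘_)
open import Relation.Binary.Definitions using (tri<; tri≈; tri>)
open import Relation.Binary.PropositionalEquality
open import Relation.Nullary using (yes; no; contradiction)

private
  variable
    n m : ℕ

+v-comm : (u v : Vector n) → u +v v ≡ v +v u
+v-comm = VecP.zipWith-comm ℚP.+-comm

+v-assoc : (u v w : Vector n) → (u +v v) +v w ≡ u +v (v +v w)
+v-assoc = VecP.zipWith-assoc ℚP.+-assoc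

+v-identityʳ : (u : Vector n) → u +v 0v ≡ u
+v-identityʳ = VecP.zipWith-identityʳ ℚP.+-identityʳ

+v-inverseʳ : (u : Vector n) → u -v u ≡ 0v
+v-inverseʳ = VecP.zipWith-inverseʳ ℚP.+-inverseʳ

+v-swap : (u v w : Vector n) → u +v (v +v w) ≡ v +v (u +v w)
+v-swap u v w = begin
  u +v (v +v w)  ≡⟨ +v-assoc u v w ⟨
  (u +v v) +v w  ≡⟨ cong (_+v w) (+v-comm u v) ⟩
  (v +v u) +v w  ≡⟨ +v-assoc v u w ⟩
  v +v (u +v w)  ∎
  where open ≡-Reasoning

u+v-u≡v : (u v : Vector n) → (u +v v) -v u ≡ v
u+v-u≡v u v = begin
  (u +v v) -v u  ≡⟨ cong (_-v u) (+v-comm u v) ⟩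
  (v +v u) -v u  ≡⟨ +v-assoc v u (-v u) ⟩
  v +v (u -v u)  ≡⟨ cong (v +v_) (+v-inverseʳ u) ⟩
  v +v 0v        ≡⟨ +v-identityʳ v ⟩
  v              ∎
  where open ≡-Reasoning

β-[-1]·α≡α+β : (α β : Vector n) → β -v ((ℚ.- 1ℚ) ·v α) ≡ α +v β
β-[-1]·α≡α+β []      []      = refl
β-[-1]·α≡α+β (x ∷ α) (y ∷ β) = cong₂ _∷_
  (solve 2 (λ x y → y :+ :- (con (ℚ.- 1ℚ) :* x) := x :+ y) refl x y) (β-[-1]·α≡α+β α β)
  where open +-*-Solver

⟨⟩-comm : (u v : Vector n) → ⟨ u , v ⟩ ≡ ⟨ v , u ⟩
⟨⟩-comm []      []      = refl
⟨⟩-comm (x ∷ u) (y ∷ v) = cong₂ ℚ._+_ (ℚP.*-comm x y) (⟨⟩-comm u v)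

⟨⟩-distribʳ : (u v w : Vector n) → ⟨ u , v +v w ⟩ ≡ ⟨ u , v ⟩ ℚ.+ ⟨ u , w ⟩
⟨⟩-distribʳ []      []      []      = sym (ℚP.+-identityʳ 0ℚ)
⟨⟩-distribʳ (x ∷ u) (y ∷ v) (z ∷ w) rewrite ⟨⟩-distribʳ u v w =
  solve 5 (λ x y z a b → x :* (y :+ z) :+ (a :+ b) := (x :* y :+ a) :+ (x :* z :+ b))
        refl x y z ⟨ u , v ⟩ ⟨ u , w ⟩
  where open +-*-Solver

⟨⟩-distribˡ : (u v w : Vector n) → ⟨ u +v v , w ⟩ ≡ ⟨ u , w ⟩ ℚ.+ ⟨ v , w ⟩
⟨⟩-distribˡ u v w = begin
  ⟨ u +v v , w ⟩           ≡⟨ ⟨⟩-comm (u +v v) w ⟩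
  ⟨ w , u +v v ⟩           ≡⟨ ⟨⟩-distribʳ w u v ⟩
  ⟨ w , u ⟩ ℚ.+ ⟨ w , v ⟩  ≡⟨ cong₂ ℚ._+_ (⟨⟩-comm w u) (⟨⟩-comm w v) ⟩
  ⟨ u , w ⟩ ℚ.+ ⟨ v , w ⟩  ∎
  where open ≡-Reasoning

⟨⟩-zeroʳ : (u : Vector n) → ⟨ u , 0v ⟩ ≡ 0ℚ
⟨⟩-zeroʳ []      = refl
⟨⟩-zeroʳ (x ∷ u) rewrite ⟨⟩-zeroʳ u | ℚP.*-zeroʳ x = ℚP.+-identityʳ 0ℚ

⟨⟩-negʳ : (u v : Vector n) → ⟨ u , -v v ⟩ ≡ ℚ.- ⟨ u , v ⟩
⟨⟩-negʳ []      []      = refl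
⟨⟩-negʳ (x ∷ u) (y ∷ v) rewrite ⟨⟩-negʳ u v =
  solve 3 (λ x y a → x :* (:- y) :+ (:- a) := :- (x :* y :+ a)) refl x y ⟨ u , v ⟩
  where open +-*-Solver

x*x-nonNeg : ∀ x → 0ℚ ℚ.≤ x ℚ.* x
x*x-nonNeg x with ℚP.≤-total x 0ℚ
... | inj₁ x≤0 = ℚP.nonNegative⁻¹ _
      {{ℚP.nonPos*nonPos⇒nonPos x {{ℚ.nonPositive x≤0}} x {{ℚ.nonPositive x≤0}}}}
... | inj₂ 0≤x = ℚP.nonNegative⁻¹ _
      {{ℚP.nonNeg*nonNeg⇒nonNeg x {{ℚ.nonNegative 0≤x}} x {{ℚ.nonNegative 0≤x}}}}

x*x≤0⇒x≡0 : ∀ x → x ℚ.* x ℚ.≤ 0ℚ → x ≡ 0ℚ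
x*x≤0⇒x≡0 x x*x≤0 with ℚP.<-cmp x 0ℚ
... | tri< x<0 _ _ = contradiction (ℚP.<-≤-trans (ℚP.positive⁻¹ _
      {{ℚP.neg*neg⇒pos x {{ℚ.negative x<0}} x {{ℚ.negative x<0}}}}) x*x≤0) (ℚP.<-irrefl refl)
... | tri≈ _ x≡0 _ = x≡0
... | tri> _ _ x>0 = contradiction (ℚP.<-≤-trans (ℚP.positive⁻¹ _
      {{ℚP.pos*pos⇒pos x {{ℚ.positive x>0}} x {{ℚ.positive x>0}}}}) x*x≤0) (ℚP.<-irrefl refl)

x+y≤0⇒x≤0 : ∀ {x y} → 0ℚ ℚ.≤ y → x ℚ.+ y ℚ.≤ 0ℚ → x ℚ.≤ 0ℚ
x+y≤0⇒x≤0 {x} {y} 0≤y x+y≤0 = begin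
  x         ≡⟨ ℚP.+-identityʳ x ⟨
  x ℚ.+ 0ℚ  ≤⟨ ℚP.+-monoʳ-≤ x 0≤y ⟩
  x ℚ.+ y   ≤⟨ x+y≤0 ⟩
  0ℚ        ∎
  where open ℚP.≤-Reasoning

⟨u,u⟩-nonNeg : (u : Vector n) → 0ℚ ℚ.≤ ⟨ u , u ⟩
⟨u,u⟩-nonNeg []      = ℚP.≤-refl
⟨u,u⟩-nonNeg (x ∷ u) = ℚP.nonNegative⁻¹ _ {{ℚP.nonNeg+nonNeg⇒nonNeg (x ℚ.* x)
  {{ℚ.nonNegative (x*x-nonNeg x)}} ⟨ u , u ⟩ {{ℚ.nonNegative (⟨u,u⟩-nonNeg u)}}}}

⟨u,u⟩≤0⇒u≡0v : (u : Vector n) → ⟨ u , u ⟩ ℚ.≤ 0ℚ → u ≡ 0v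
⟨u,u⟩≤0⇒u≡0v []      _  = refl
⟨u,u⟩≤0⇒u≡0v (x ∷ u) le = cong₂ _∷_
  (x*x≤0⇒x≡0 x (x+y≤0⇒x≤0 (⟨u,u⟩-nonNeg u) le))
  (⟨u,u⟩≤0⇒u≡0v u (x+y≤0⇒x≤0 (x*x-nonNeg x) (subst (ℚ._≤ 0ℚ) (ℚP.+-comm (x ℚ.* x) ⟨ u , u ⟩) le)))

⟨u,vecSum⟩-nonPos : ∀ (u : Vector n) (ys : Vec (Vector n) m) →
                    All (λ y → ⟨ u , y ⟩ ℚ.≤ 0ℚ) ys → ⟨ u , vecSum ys ⟩ ℚ.≤ 0ℚ
⟨u,vecSum⟩-nonPos u []       []         = ℚP.≤-reflexive (⟨⟩-zeroʳ u)
⟨u,vecSum⟩-nonPos u (y ∷ ys) (py ∷ pys) = begin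
  ⟨ u , y +v vecSum ys ⟩           ≡⟨ ⟨⟩-distribʳ u y (vecSum ys) ⟩
  ⟨ u , y ⟩ ℚ.+ ⟨ u , vecSum ys ⟩  ≤⟨ ℚP.+-mono-≤ py (⟨u,vecSum⟩-nonPos u ys pys) ⟩
  0ℚ ℚ.+ 0ℚ                        ≡⟨ ℚP.+-identityʳ 0ℚ ⟩
  0ℚ                               ∎
  where open ℚP.≤-Reasoning

⟨vecSum,∙⟩≤0⇒vecSum≡0v : (ys : Vec (Vector n) m) →
                         All (λ y → ⟨ vecSum ys , y ⟩ ℚ.≤ 0ℚ) ys → vecSum ys ≡ 0v
⟨vecSum,∙⟩≤0⇒vecSum≡0v ys obtuse =
  ⟨u,u⟩≤0⇒u≡0v (vecSum ys) (⟨u,vecSum⟩-nonPos (vecSum ys) ys obtuse)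

2ℚ : ℚ
2ℚ = ℤ.+ 2 ℚ./ 1

ℤ/1<0⇒≡-1⊎≤-2 : ∀ z → z ℚ./ 1 ℚ.< 0ℚ → z ℚ./ 1 ≡ ℚ.- 1ℚ ⊎ z ℚ./ 1 ℚ.≤ ℚ.- 2ℚ
ℤ/1<0⇒≡-1⊎≤-2 (ℤ.+ k)        z<0 = contradiction
  (ℚP.<-≤-trans z<0 (ℚP.nonNegative⁻¹ _ {{ℚP.normalize-nonNeg k 1}})) (ℚP.<-irrefl refl)
ℤ/1<0⇒≡-1⊎≤-2 ℤ.-[1+ zero ]  _   = inj₁ refl
ℤ/1<0⇒≡-1⊎≤-2 ℤ.-[1+ suc k ] _   = inj₂ (ℚP.neg-antimono-≤ 2≤2+k)
  where
  2≤2+k : 2ℚ ℚ.≤ ℚ.normalize (suc (suc k)) 1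
  2≤2+k rewrite ℚP.normalize-coprime {suc (suc k)} {0} (Coprime.sym (Coprime.1-coprimeTo _)) =
    ℚ.*≤* (ℤ.+≤+ (s≤s (s≤s ℕ.z≤n)))

module _ {a b c : ℚ} (0≤a : 0ℚ ℚ.≤ a) (c*a≡2b : c ℚ.* a ≡ 2ℚ ℚ.* b) where
  private instance _ = ℚ.nonNegative 0≤a

  c*a≡2b∧b<0⇒c<0 : b ℚ.< 0ℚ → c ℚ.< 0ℚ
  c*a≡2b∧b<0⇒c<0 b<0 = ℚP.*-cancelʳ-<-nonNeg a (begin-strict
    c ℚ.* a    ≡⟨ c*a≡2b ⟩
    2ℚ ℚ.* b   <⟨ ℚP.*-monoʳ-<-pos 2ℚ b<0 ⟩
    2ℚ ℚ.* 0ℚ  ≡⟨ ℚP.*-zeroʳ 2ℚ ⟩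
    0ℚ         ≡⟨ ℚP.*-zeroˡ a ⟨
    0ℚ ℚ.* a   ∎)
    where open ℚP.≤-Reasoning

  c*a≡2b∧c≤-2⇒a+b≤0 : c ℚ.≤ ℚ.- 2ℚ → a ℚ.+ b ℚ.≤ 0ℚ
  c*a≡2b∧c≤-2⇒a+b≤0 c≤-2 = ℚP.*-cancelˡ-≤-pos 2ℚ (begin
    2ℚ ℚ.* (a ℚ.+ b)             ≡⟨ ℚP.*-distribˡ-+ 2ℚ a b ⟩
    2ℚ ℚ.* a ℚ.+ 2ℚ ℚ.* b        ≡⟨ cong (2ℚ ℚ.* a ℚ.+_) c*a≡2b ⟨
    2ℚ ℚ.* a ℚ.+ c ℚ.* a         ≤⟨ ℚP.+-monoʳ-≤ (2ℚ ℚ.* a) (ℚP.*-monoʳ-≤-nonNeg a c≤-2) ⟩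
    2ℚ ℚ.* a ℚ.+ ℚ.- 2ℚ ℚ.* a    ≡⟨ solve 1 (λ a → con 2ℚ :* a :+ :- con 2ℚ :* a := con 2ℚ :* con 0ℚ)
                                          refl a ⟩
    2ℚ ℚ.* 0ℚ                    ∎)
    where open ℚP.≤-Reasoning
          open +-*-Solver

coPair-spec : (α β : Vector n) → α ≢ 0v → coPair α β ℚ.* ⟨ α , α ⟩ ≡ 2ℚ ℚ.* ⟨ α , β ⟩
coPair-spec α β α≢0 with ⟨ α , α ⟩ ℚ.≟ 0ℚ
... | yes ⟨α,α⟩≡0 = contradiction (⟨u,u⟩≤0⇒u≡0v α (ℚP.≤-reflexive ⟨α,α⟩≡0)) α≢0
... | no  ⟨α,α⟩≢0 = begin
  (p ℚ.* ℚ.1/ a) ℚ.* a  ≡⟨ ℚP.*-assoc p (ℚ.1/ a) a ⟩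
  p ℚ.* (ℚ.1/ a ℚ.* a)  ≡⟨ cong (p ℚ.*_) (ℚP.*-inverseˡ a) ⟩
  p ℚ.* 1ℚ              ≡⟨ ℚP.*-identityʳ p ⟩
  p                     ∎
  where
  open ≡-Reasoning
  instance _ = ℚ.≢-nonZero ⟨α,α⟩≢0
  a = ⟨ α , α ⟩
  p = 2ℚ ℚ.* ⟨ α , β ⟩

lookup-removeAt : ∀ {A : Set} (xs : Vec A (suc m)) (i : Fin (suc m)) (l : Fin m) →
                  lookup (removeAt xs i) l ≡ lookup xs (punchIn i l)
lookup-removeAt xs i l = begin
  lookup (removeAt xs i) l
    ≡⟨ VecP.insertAt-punchIn (removeAt xs i) i (lookup xs i) l ⟨
  lookup (insertAt (removeAt xs i) i (lookup xs i)) (punchIn i l)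
    ≡⟨ cong (λ zs → lookup zs (punchIn i l)) (VecP.insertAt-removeAt xs i) ⟩
  lookup xs (punchIn i l)
    ∎
  where open ≡-Reasoning

insertAt-injective : ∀ {A : Set} (xs ys : Vec A m) (i : Fin (suc m)) (v : A) →
                     insertAt xs i v ≡ insertAt ys i v → xs ≡ ys
insertAt-injective xs ys i v eq = begin
  xs                            ≡⟨ VecP.removeAt-insertAt xs i v ⟨
  removeAt (insertAt xs i v) i  ≡⟨ cong (λ zs → removeAt zs i) eq ⟩
  removeAt (insertAt ys i v) i  ≡⟨ VecP.removeAt-insertAt ys i v ⟩
  ys                            ∎
  where open ≡-Reasoning

lookup-∷-map-injective : ∀ {A B : Set} {x : B} {f : A → B} {xs : Vec A m} →
  (∀ u v → f u ≡ f v → u ≡ v) → (∀ u → f u ≢ x) → (∀ a b → lookup xs a ≡ lookup xs b → a ≡ b) →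
  ∀ a b → lookup (x ∷ Vec.map f xs) a ≡ lookup (x ∷ Vec.map f xs) b → a ≡ b
lookup-∷-map-injective              f-inj f≢x xs-inj zero    zero    _  = refl
lookup-∷-map-injective {f = f} {xs} f-inj f≢x xs-inj zero    (suc b) eq =
  contradiction (sym (trans eq (VecP.lookup-map b f xs))) (f≢x (lookup xs b))
lookup-∷-map-injective {f = f} {xs} f-inj f≢x xs-inj (suc a) zero    eq =
  contradiction (trans (sym (VecP.lookup-map a f xs)) eq) (f≢x (lookup xs a))
lookup-∷-map-injective {f = f} {xs} f-inj f≢x xs-inj (suc a) (suc b) eq = cong suc (xs-inj a b
  (f-inj _ _ (trans (sym (VecP.lookup-map a f xs)) (trans eq (VecP.lookup-map b f xs)))))

all-removeAt : ∀ {A : Set} {P : A → Set} {xs : Vec A (suc m)} → All P xs → ∀ i → All P (removeAt xs i)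
all-removeAt (px ∷ pxs)         zero    = pxs
all-removeAt (px ∷ pxs@(_ ∷ _)) (suc i) = px ∷ all-removeAt pxs i

vecSum-insertAt : (ys : Vec (Vector n) m) (i : Fin (suc m)) (y : Vector n) →
                  vecSum (insertAt ys i y) ≡ y +v vecSum ys
vecSum-insertAt ys       zero    y = refl
vecSum-insertAt (x ∷ ys) (suc i) y =
  trans (cong (x +v_) (vecSum-insertAt ys i y)) (+v-swap x y (vecSum ys))

lookup+vecSum-removeAt : (xs : Vec (Vector n) (suc m)) (i : Fin (suc m)) →
                         lookup xs i +v vecSum (removeAt xs i) ≡ vecSum xs
lookup+vecSum-removeAt xs i = trans (sym (vecSum-insertAt (removeAt xs i) i (lookup xs i)))
                                    (cong vecSum (VecP.insertAt-removeAt xs i))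

vecSum-removeAt : (xs : Vec (Vector n) (suc m)) (i : Fin (suc m)) →
                  vecSum (removeAt xs i) ≡ vecSum xs -v lookup xs i
vecSum-removeAt xs i = trans (sym (u+v-u≡v (lookup xs i) (vecSum (removeAt xs i))))
                             (cong (_-v lookup xs i) (lookup+vecSum-removeAt xs i))

subsetSum-⊤ : (xs : Vec (Vector n) m) → subsetSum xs ⊤ ≡ vecSum xs
subsetSum-⊤ []       = refl
subsetSum-⊤ (x ∷ xs) = cong (x +v_) (subsetSum-⊤ xs)

subsetSum-⊥ : (xs : Vec (Vector n) m) → subsetSum xs ⊥ ≡ 0v
subsetSum-⊥ []       = refl
subsetSum-⊥ (x ∷ xs) = subsetSum-⊥ xs

subsetSum-insertAt : (ys : Vec (Vector n) m) (i : Fin (suc m)) (y : Vector n) (T : Subset m) (b : Bool) →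
                     subsetSum (insertAt ys i y) (insertAt T i b) ≡ subsetSum (y ∷ ys) (b ∷ T)
subsetSum-insertAt ys       zero    y T             b       = refl
subsetSum-insertAt (x ∷ ys) (suc i) y (outside ∷ T) outside = subsetSum-insertAt ys i y T outside
subsetSum-insertAt (x ∷ ys) (suc i) y (outside ∷ T) inside  = subsetSum-insertAt ys i y T inside
subsetSum-insertAt (x ∷ ys) (suc i) y (inside ∷ T)  outside =
  cong (x +v_) (subsetSum-insertAt ys i y T outside)
subsetSum-insertAt (x ∷ ys) (suc i) y (inside ∷ T)  inside  =
  trans (cong (x +v_) (subsetSum-insertAt ys i y T inside)) (+v-swap x y (subsetSum ys T))

subsetSum-removeAt : (xs : Vec (Vector n) (suc m)) (i : Fin (suc m)) (T : Subset m) (b : Bool) →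
                     subsetSum xs (insertAt T i b) ≡ subsetSum (lookup xs i ∷ removeAt xs i) (b ∷ T)
subsetSum-removeAt xs i T b =
  trans (cong (λ zs → subsetSum zs (insertAt T i b)) (sym (VecP.insertAt-removeAt xs i)))
        (subsetSum-insertAt (removeAt xs i) i (lookup xs i) T b)

∣insertAt∣≡∣∷∣ : (T : Subset m) (i : Fin (suc m)) (b : Bool) → ∣ insertAt T i b ∣ ≡ ∣ b ∷ T ∣
∣insertAt∣≡∣∷∣ T             zero    b       = refl
∣insertAt∣≡∣∷∣ (outside ∷ T) (suc i) outside = ∣insertAt∣≡∣∷∣ T i outside
∣insertAt∣≡∣∷∣ (outside ∷ T) (suc i) inside  = ∣insertAt∣≡∣∷∣ T i inside
∣insertAt∣≡∣∷∣ (inside ∷ T)  (suc i) outside = cong suc (∣insertAt∣≡∣∷∣ T i outside)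
∣insertAt∣≡∣∷∣ (inside ∷ T)  (suc i) inside  = cong suc (∣insertAt∣≡∣∷∣ T i inside)

nonempty-insertAt : ∀ {T : Subset m} {b} i → Nonempty (b ∷ T) → Nonempty (insertAt T i b)
nonempty-insertAt {T = T} i (zero , here) =
  i , VecP.lookup⇒[]= i _ (VecP.insertAt-lookup T i inside)
nonempty-insertAt {T = T} {b} i (suc l , there l∈T) =
  punchIn i l , VecP.lookup⇒[]= _ _ (trans (VecP.insertAt-punchIn T i b l) (VecP.[]=⇒lookup l∈T))

noVanishingSubsum-tail : ∀ {x} {xs : Vec (Vector n) m} →
                         NoVanishingSubsum (x ∷ xs) → NoVanishingSubsum xs
noVanishingSubsum-tail nvs T (l , l∈T) = nvs (outside ∷ T) (suc l , there l∈T)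

noVanishingSubsum-rotate : ∀ (xs : Vec (Vector n) (suc m)) i →
                           NoVanishingSubsum xs → NoVanishingSubsum (lookup xs i ∷ removeAt xs i)
noVanishingSubsum-rotate xs i nvs (b ∷ T) ne sum≡0 =
  nvs (insertAt T i b) (nonempty-insertAt i ne) (trans (subsetSum-removeAt xs i T b) sum≡0)

noVanishingSubsum-removeAt : ∀ (xs : Vec (Vector n) (suc m)) i →
                             NoVanishingSubsum xs → NoVanishingSubsum (removeAt xs i)
noVanishingSubsum-removeAt xs i nvs = noVanishingSubsum-tail (noVanishingSubsum-rotate xs i nvs)

noVanishingSubsum-∷-+v : ∀ {x y} {zs : Vec (Vector n) m} →
                         NoVanishingSubsum (x ∷ y ∷ zs) → NoVanishingSubsum ((x +v y) ∷ zs)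
noVanishingSubsum-∷-+v nvs (outside ∷ T) (suc l , there l∈T) =
  nvs (outside ∷ outside ∷ T) (suc (suc l) , there (there l∈T))
noVanishingSubsum-∷-+v {x = x} {y} {zs} nvs (inside ∷ T) _ sum≡0 =
  nvs (inside ∷ inside ∷ T) (zero , here) (trans (sym (+v-assoc x y (subsetSum zs T))) sum≡0)

noVanishingSubsum⇒head≢0v : ∀ {x} {xs : Vec (Vector n) m} → NoVanishingSubsum (x ∷ xs) → x ≢ 0v
noVanishingSubsum⇒head≢0v {x = x} {xs} nvs x≡0 = nvs (inside ∷ ⊥) (zero , here)
  (trans (cong (x +v_) (subsetSum-⊥ xs)) (trans (+v-identityʳ x) x≡0))

noVanishingSubsum⇒vecSum≢0v : ∀ (xs : Vec (Vector n) (suc m)) → NoVanishingSubsum xs → vecSum xs ≢ 0v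
noVanishingSubsum⇒vecSum≢0v xs nvs σ≡0 = nvs ⊤ (zero , here) (trans (subsetSum-⊤ xs) σ≡0)

merge : Vec (Vector n) (suc (suc m)) → Fin (suc m) → Vec (Vector n) (suc m)
merge (x ∷ ys) j = (lookup ys j +v x) ∷ removeAt ys j

vecSum-merge : (xs : Vec (Vector n) (suc (suc m))) (j : Fin (suc m)) → vecSum (merge xs j) ≡ vecSum xs
vecSum-merge xs@(x ∷ ys@(_ ∷ _)) j =
  trans (+v-assoc (lookup ys j) x (vecSum (removeAt ys j))) (lookup+vecSum-removeAt xs (suc j))

vecSum-removeAt-merge : (xs : Vec (Vector n) (suc (suc (suc m)))) (j : Fin (suc (suc m))) (l : Fin (suc m)) →
                        vecSum (removeAt (merge xs j) (suc l)) ≡ vecSum (removeAt xs (suc (punchIn j l)))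
vecSum-removeAt-merge xs@(x ∷ ys) j l = begin
  vecSum (removeAt (merge xs j) (suc l))           ≡⟨ vecSum-removeAt (merge xs j) (suc l) ⟩
  vecSum (merge xs j) -v lookup (removeAt ys j) l  ≡⟨ cong₂ _-v_ (vecSum-merge xs j) (lookup-removeAt ys j l) ⟩
  vecSum xs -v lookup ys (punchIn j l)             ≡⟨ vecSum-removeAt xs (suc (punchIn j l)) ⟨
  vecSum (removeAt xs (suc (punchIn j l)))         ∎
  where open ≡-Reasoning

noVanishingSubsum-merge : (xs : Vec (Vector n) (suc (suc m))) (j : Fin (suc m)) →
                          NoVanishingSubsum xs → NoVanishingSubsum (merge xs j)
noVanishingSubsum-merge xs@(_ ∷ _ ∷ _) j nvs =
  noVanishingSubsum-∷-+v (noVanishingSubsum-rotate xs (suc j) nvs)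

module _ {Φ : List (Vector n)} (isR : IsRootSystem Φ) (cryst : Crystallographic Φ) where
  open IsRootSystem isR

  coPair<0⇒≡-1⊎≤-2 : ∀ {α β} → α ∈ Φ → β ∈ Φ → ⟨ α , β ⟩ ℚ.< 0ℚ →
                      coPair α β ≡ ℚ.- 1ℚ ⊎ coPair α β ℚ.≤ ℚ.- 2ℚ
  coPair<0⇒≡-1⊎≤-2 {α} {β} α∈Φ β∈Φ ⟨α,β⟩<0 with cryst α∈Φ β∈Φ
  ... | z , c≡z rewrite c≡z = ℤ/1<0⇒≡-1⊎≤-2 z (subst (ℚ._< 0ℚ) c≡z
    (c*a≡2b∧b<0⇒c<0 (⟨u,u⟩-nonNeg α) (coPair-spec α β (nonzero α∈Φ)) ⟨α,β⟩<0))

  +v-∈-or-obtuse : ∀ {α β} → α ∈ Φ → β ∈ Φ → ⟨ α , β ⟩ ℚ.< 0ℚ →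
                   α +v β ∈ Φ ⊎ ⟨ α , α ⟩ ℚ.+ ⟨ α , β ⟩ ℚ.≤ 0ℚ
  +v-∈-or-obtuse {α} {β} α∈Φ β∈Φ ⟨α,β⟩<0 with coPair<0⇒≡-1⊎≤-2 α∈Φ β∈Φ ⟨α,β⟩<0
  ... | inj₁ c≡-1 = inj₁ (subst (_∈ Φ) sα[β]≡α+β (reflClosed α∈Φ β∈Φ))
    where
    sα[β]≡α+β : refl-s α β ≡ α +v β
    sα[β]≡α+β = trans (cong (λ c → β -v (c ·v α)) c≡-1) (β-[-1]·α≡α+β α β)
  ... | inj₂ c≤-2 = inj₂ (c*a≡2b∧c≤-2⇒a+b≤0 (⟨u,u⟩-nonNeg α) (coPair-spec α β (nonzero α∈Φ)) c≤-2)

  +v-∈-or-≡0v : ∀ {α β} → α ∈ Φ → β ∈ Φ → ⟨ α , β ⟩ ℚ.< 0ℚ → α +v β ∈ Φ ⊎ α +v β ≡ 0v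
  +v-∈-or-≡0v {α} {β} α∈Φ β∈Φ ⟨α,β⟩<0
    with +v-∈-or-obtuse α∈Φ β∈Φ ⟨α,β⟩<0
       | +v-∈-or-obtuse β∈Φ α∈Φ (subst (ℚ._< 0ℚ) (⟨⟩-comm α β) ⟨α,β⟩<0)
  ... | inj₁ α+β∈Φ    | _             = inj₁ α+β∈Φ
  ... | inj₂ _        | inj₁ β+α∈Φ    = inj₁ (subst (_∈ Φ) (+v-comm β α) β+α∈Φ)
  ... | inj₂ α-obtuse | inj₂ β-obtuse = inj₂ (⟨u,u⟩≤0⇒u≡0v (α +v β) (begin
    ⟨ α +v β , α +v β ⟩
      ≡⟨ ⟨⟩-distribˡ α β (α +v β) ⟩
    ⟨ α , α +v β ⟩ ℚ.+ ⟨ β , α +v β ⟩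
      ≡⟨ cong (λ v → ⟨ α , α +v β ⟩ ℚ.+ ⟨ β , v ⟩) (+v-comm α β) ⟩
    ⟨ α , α +v β ⟩ ℚ.+ ⟨ β , β +v α ⟩
      ≡⟨ cong₂ ℚ._+_ (⟨⟩-distribʳ α α β) (⟨⟩-distribʳ β β α) ⟩
    (⟨ α , α ⟩ ℚ.+ ⟨ α , β ⟩) ℚ.+ (⟨ β , β ⟩ ℚ.+ ⟨ β , α ⟩)
      ≤⟨ ℚP.+-mono-≤ α-obtuse β-obtuse ⟩
    0ℚ ℚ.+ 0ℚ
      ≡⟨ ℚP.+-identityʳ 0ℚ ⟩
    0ℚ
      ∎))
    where open ℚP.≤-Reasoning

  summable-removeAt-acute : ∀ (xs : Vec (Vector n) (suc (suc m))) → All (_∈ Φ) xs → Summable Φ xs →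
    NoVanishingSubsum xs → ∀ i → 0ℚ ℚ.< ⟨ vecSum xs , lookup xs i ⟩ → Summable Φ (removeAt xs i)
  summable-removeAt-acute xs xs⊆Φ σ∈Φ nvs i acute
    with +v-∈-or-≡0v σ∈Φ (neg-mem (lookup⁺ xs⊆Φ i)) ⟨σ,-xᵢ⟩<0
    where
    ⟨σ,-xᵢ⟩<0 : ⟨ vecSum xs , -v lookup xs i ⟩ ℚ.< 0ℚ
    ⟨σ,-xᵢ⟩<0 = subst (ℚ._< 0ℚ) (sym (⟨⟩-negʳ (vecSum xs) (lookup xs i))) (ℚP.neg-antimono-< acute)
  ... | inj₁ σ-xᵢ∈Φ = subst (_∈ Φ) (sym (vecSum-removeAt xs i)) σ-xᵢ∈Φ
  ... | inj₂ σ-xᵢ≡0 = contradiction (trans (vecSum-removeAt xs i) σ-xᵢ≡0)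
    (noVanishingSubsum⇒vecSum≢0v (removeAt xs i) (noVanishingSubsum-removeAt xs i nvs))

  summable-removeAt-suc : ∀ (xs : Vec (Vector n) (suc (suc m))) → All (_∈ Φ) xs → Summable Φ xs →
    NoVanishingSubsum xs → ∃ λ j → Summable Φ (removeAt xs (suc j))
  summable-removeAt-suc (x ∷ _ ∷ []) (x∈Φ ∷ _) _ _ = zero , subst (_∈ Φ) (sym (+v-identityʳ x)) x∈Φ
  summable-removeAt-suc xs@(x ∷ ys@(_ ∷ _ ∷ _)) xs⊆Φ σ∈Φ nvs
    with FinP.any? (λ j → 0ℚ ℚP.<? ⟨ vecSum xs , lookup ys j ⟩)
  ... | yes (j , acute) = j , summable-removeAt-acute xs xs⊆Φ σ∈Φ nvs (suc j) acute
  ... | no ¬acute with FinP.any? (λ j → ⟨ lookup ys j , x ⟩ ℚP.<? 0ℚ)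
  ...   | yes (j , obtuse) with +v-∈-or-≡0v (lookup⁺ (All.tail xs⊆Φ) j) (All.head xs⊆Φ) obtuse
  ...     | inj₂ yⱼ+x≡0 =
    contradiction yⱼ+x≡0 (noVanishingSubsum⇒head≢0v (noVanishingSubsum-merge xs j nvs))
  ...     | inj₁ yⱼ+x∈Φ with summable-removeAt-suc (merge xs j)
                               (yⱼ+x∈Φ ∷ all-removeAt (All.tail xs⊆Φ) j)
                               (subst (_∈ Φ) (sym (vecSum-merge xs j)) σ∈Φ)
                               (noVanishingSubsum-merge xs j nvs)
  ...       | l , summable = punchIn j l , subst (_∈ Φ) (vecSum-removeAt-merge xs j l) summable
  summable-removeAt-suc xs@(x ∷ ys@(_ ∷ _ ∷ _)) xs⊆Φ σ∈Φ nvs | no ¬acute | no ¬obtuse =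
    contradiction (⟨vecSum,∙⟩≤0⇒vecSum≡0v ys (lookup⁻ ⟨Σys,yⱼ⟩≤0))
                  (noVanishingSubsum⇒vecSum≢0v ys (noVanishingSubsum-tail nvs))
    where
    ⟨Σys,yⱼ⟩≤0 : ∀ j → ⟨ vecSum ys , lookup ys j ⟩ ℚ.≤ 0ℚ
    ⟨Σys,yⱼ⟩≤0 j = x+y≤0⇒x≤0 (subst (0ℚ ℚ.≤_) (⟨⟩-comm (lookup ys j) x) (ℚP.≮⇒≥ (¬obtuse ∘ (j ,_))))
      (begin
        ⟨ vecSum ys , lookup ys j ⟩ ℚ.+ ⟨ x , lookup ys j ⟩
          ≡⟨ ℚP.+-comm ⟨ vecSum ys , lookup ys j ⟩ ⟨ x , lookup ys j ⟩ ⟩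
        ⟨ x , lookup ys j ⟩ ℚ.+ ⟨ vecSum ys , lookup ys j ⟩
          ≡⟨ ⟨⟩-distribˡ x (vecSum ys) (lookup ys j) ⟨
        ⟨ vecSum xs , lookup ys j ⟩
          ≤⟨ ℚP.≮⇒≥ (¬acute ∘ (j ,_)) ⟩
        0ℚ
          ∎)
      where open ℚP.≤-Reasoning

  summable-subsets-∋-head : ∀ {k} (xs : Vec (Vector n) (suc k)) → All (_∈ Φ) xs → Summable Φ xs →
    NoVanishingSubsum xs → ∀ {s} → s ≤ k →
    ∃ λ (T : Subset k) → ∣ T ∣ ≡ s × subsetSum xs (inside ∷ T) ∈ Φ
  summable-subsets-∋-head xs xs⊆Φ σ∈Φ nvs s≤k with ℕP.m≤n⇒m<n∨m≡n s≤k
  ... | inj₂ refl = ⊤ , ∣⊤∣≡n _ , subst (_∈ Φ) (sym (subsetSum-⊤ xs)) σ∈Φ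
  ... | inj₁ (s≤s s≤k-1) with summable-removeAt-suc xs xs⊆Φ σ∈Φ nvs
  ...   | j , summable with summable-subsets-∋-head (removeAt xs (suc j)) (all-removeAt xs⊆Φ (suc j))
                              summable (noVanishingSubsum-removeAt xs (suc j) nvs) s≤k-1
  ...     | T , ∣T∣≡s , T-summable =
    insertAt T j outside ,
    trans (∣insertAt∣≡∣∷∣ T j outside) ∣T∣≡s ,
    subst (_∈ Φ) (sym (subsetSum-removeAt xs (suc j) (inside ∷ T) outside)) T-summable

  SummableFamily : ∀ {k} → Vec (Vector n) k → ℕ → ℕ → Set
  SummableFamily {k} xs p s = ∃ λ (F : Vec (Subset k) p) → (∀ a b → lookup F a ≡ lookup F b → a ≡ b) ×
    (∀ a → (∣ lookup F a ∣ ≡ s) × (subsetSum xs (lookup F a) ∈ Φ))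

  summableFamily-extend : ∀ {k p s} (xs : Vec (Vector n) (suc k)) i (T : Subset k) → suc ∣ T ∣ ≡ s →
    subsetSum (lookup xs i ∷ removeAt xs i) (inside ∷ T) ∈ Φ →
    SummableFamily (removeAt xs i) p s → SummableFamily xs (suc p) s
  summableFamily-extend {s = s} xs i T ∣U∣≡s U-summable (F , F-inj , F-props) =
    U ∷ Vec.map lift F , lookup-∷-map-injective lift-inj lift≢U F-inj , props
    where
    U = insertAt T i inside
    lift : Subset _ → Subset _
    lift S = insertAt S i outside
    lift-inj : ∀ S S′ → lift S ≡ lift S′ → S ≡ S′
    lift-inj S S′ = insertAt-injective S S′ i outside
    lift≢U : ∀ S → lift S ≢ U
    lift≢U S eq with trans (sym (VecP.insertAt-lookup S i outside))
                       (trans (cong (λ V → lookup V i) eq) (VecP.insertAt-lookup T i inside))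
    ... | ()
    props : ∀ a → (∣ lookup (U ∷ Vec.map lift F) a ∣ ≡ s) × (subsetSum xs (lookup (U ∷ Vec.map lift F) a) ∈ Φ)
    props zero = trans (∣insertAt∣≡∣∷∣ T i inside) ∣U∣≡s ,
                 subst (_∈ Φ) (sym (subsetSum-removeAt xs i T inside)) U-summable
    props (suc a) rewrite VecP.lookup-map a lift F =
      trans (∣insertAt∣≡∣∷∣ (lookup F a) i outside) (proj₁ (F-props a)) ,
      subst (_∈ Φ) (sym (subsetSum-removeAt xs i (lookup F a) outside)) (proj₂ (F-props a))

  summable-subsets : ∀ {k} (xs : Vec (Vector n) k) → All (_∈ Φ) xs → Summable Φ xs → NoVanishingSubsum xs →
    ∀ p → 1 ≤ p → p ≤ k → SummableFamily xs p (k ∸ p + 1)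
  summable-subsets {suc k} xs _ σ∈Φ _ 1 _ _ =
    ⊤ ∷ [] ,
    (λ { zero zero _ → refl }) ,
    (λ { zero → trans (∣⊤∣≡n (suc k)) (ℕP.+-comm 1 k) , subst (_∈ Φ) (sym (subsetSum-⊤ xs)) σ∈Φ })
  summable-subsets {suc (suc k)} xs xs⊆Φ σ∈Φ nvs (suc (suc q)) _ (s≤s (s≤s q≤k)) =
    let j , summable = summable-removeAt-suc xs xs⊆Φ σ∈Φ nvs
        i = suc j
        T , ∣T∣≡k∸q , T-summable = summable-subsets-∋-head (lookup xs i ∷ removeAt xs i)
          (lookup⁺ xs⊆Φ i ∷ all-removeAt xs⊆Φ i) (subst (_∈ Φ) (sym (lookup+vecSum-removeAt xs i)) σ∈Φ)
          (noVanishingSubsum-rotate xs i nvs) (ℕP.≤-trans (ℕP.m∸n≤m k q) (ℕP.n≤1+n k))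
    in summableFamily-extend xs i T (trans (cong suc ∣T∣≡k∸q) (ℕP.+-comm 1 (k ∸ q))) T-summable
         (summable-subsets (removeAt xs i) (all-removeAt xs⊆Φ i) summable
            (noVanishingSubsum-removeAt xs i nvs) (suc q) (s≤s ℕ.z≤n) (s≤s q≤k))

-- Subsets are sets of indices, so the hypothesis that the roots of X are pairwise distinct is not needed.
theorem2p5 : ∀ {n : ℕ} (Φ : List (Vector n)) → IsRootSystem Φ → Crystallographic Φ →
    ∀ {k : ℕ} (X : Vec (Vector n) k) →
    (∀ i → lookup X i ∈ Φ) →
    (∀ i j → lookup X i ≡ lookup X j → i ≡ j) →
    Summable Φ X → NoVanishingSubsum X →
    ∀ (p : ℕ) → 1 ≤ p → p ≤ k →
    ∃ λ (F : Vec (Subset k) p) →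
      (∀ a b → lookup F a ≡ lookup F b → a ≡ b) ×
      (∀ a → (∣ lookup F a ∣ ≡ k ∸ p + 1) × (subsetSum X (lookup F a) ∈ Φ))
theorem2p5 Φ isR cryst X X⊆Φ _ = summable-subsets isR cryst X (lookup⁻ X⊆Φ)
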